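{- Let $g>0$ be a rational number with $g\ne 1$ and let $d$ be a positive integer. Then $$N_{ -g}(d)(x)=\begin{cases}N_g(d/2)(x)+N_g(2d)(x)-N_g(d)(x)+O(1) & \text{if } d\equiv 2 \pmod 4;\\ N_g(d)(x)+O(1)& \text{otherwise.}\end{cases}$$ In particular, $$\delta_{ -g}(d)=\begin{cases}\delta_g(d/2)+\delta_g(2d)-\delta_g(d) &\text{if } d\equiv 2 \pmod 4;\\ \delta_g(d) & \text{otherwise.}\end{cases}$$
   Context: For a rational $a\notin\{ -1,0,1\}$ and a prime $p$ with $\nu_p(a)=0$, ${\rm ord}_p(a)$ is the multiplicative order of $a$ modulo $p$. $N_a(d)(x)$ is the number of primes $p\le x$ (with $\nu_p(a)=0$) such that $d\mid{\rm ord}_p(a)$, and $\delta_a(d)$ is the natural density of the set of such primes. -}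

module Defs where

open import Data.Bool using (Bool; true; false)
open import Data.Nat as ℕ using (ℕ; zero; suc; _≡ᵇ_; _%_)
open import Data.Nat.Divisibility using (_∣_; _∣?_)
open import Data.Nat.Primality using (Prime; prime?)
open import Data.Integer as ℤ using (ℤ; +_)
open import Data.Rational using (ℚ; ↥_; ↧ₙ_)
open import Data.List using (List; length; filter; upTo)
open import Data.Product using (_×_)
open import Relation.Nullary using (¬_; Dec)
open import Relation.Nullary.Decidable using (_×-dec_; ¬?)

-- A rational a is written in lowest terms as (↥ a) / (↧ₙ a).
-- ν_p(a) = 0  iff  p divides neither the numerator nor the denominator.
ValuationZero : ℚ → ℕ → Set
ValuationZero a p = ¬ (p ∣ ℤ.∣ ↥ a ∣) × ¬ (p ∣ ↧ₙ a)

valuationZero? : (a : ℚ) (p : ℕ) → Dec (ValuationZero a p)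
valuationZero? a p = ¬? (p ∣? ℤ.∣ ↥ a ∣) ×-dec ¬? (p ∣? ↧ₙ a)

-- isOne a q k : does a^k ≡ 1 (mod suc q), i.e. (suc q) ∣ num^k - den^k ?
isOne : ℚ → ℕ → ℕ → Bool
isOne a q k = (((↥ a) ℤ.^ k ℤ.- (+ (↧ₙ a)) ℤ.^ k) ℤ.%ℕ suc q) ≡ᵇ 0

-- least k ≥ start (within fuel steps) with a^k ≡ 1 mod (suc q); 0 if none
search : ℚ → (q fuel start : ℕ) → ℕ
search a q zero    k = 0
search a q (suc f) k with isOne a q k
... | true  = k
... | false = search a q f (suc k)

-- ord_p(a): multiplicative order of a modulo p (for p prime with ν_p(a)=0
-- it is the least k ∈ {1,…,p-1} with a^k ≡ 1 mod p; junk value 0 otherwise).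
ord : ℚ → ℕ → ℕ
ord a zero    = 0
ord a (suc q) = search a q (suc q) 1

Counted : ℚ → ℕ → ℕ → Set
Counted a d p = Prime p × ValuationZero a p × (d ∣ ord a p)

counted? : (a : ℚ) (d p : ℕ) → Dec (Counted a d p)
counted? a d p = prime? p ×-dec valuationZero? a p ×-dec (d ∣? ord a p)

N : ℚ → ℕ → ℕ → ℕ
N a d x = length (filter (counted? a d) (upTo (suc x)))

primeCount : ℕ → ℕ
primeCount x = length (filter prime? (upTo (suc x)))

RHS : ℚ → ℕ → ℕ → ℤ
RHS g d x with d % 4 ≡ᵇ 2
... | true  = (+ N g (d ℕ./ 2) x) ℤ.+ (+ N g (2 ℕ.* d) x) ℤ.- (+ N g d x)
... | false = + N g d x

Err : ℚ → ℕ → ℕ → ℤ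
Err g d x = (+ N (Data.Rational.-_ g) d x) ℤ.- RHS g d x

{-# OPTIONS --safe #-}

-- For an odd prime p not dividing the numerator or denominator of g, let o and o′ be the
-- orders of g and −g modulo p. As (−g)^k = g^k for even k, (−g)^k = −g^k for odd k and
-- −1 ≢ 1 (mod p), one finds o′ = 2o if o is odd, o′ = o/2 if o ≡ 2 (mod 4) and o′ = o if
-- 4 ∣ o. Hence d ∣ o′ ⇔ d ∣ o unless d ≡ 2 (mod 4), while for d = 2e with e odd
-- [d ∣ o′] + [d ∣ o] = [e ∣ o] + [2d ∣ o]. Summing over p ≤ x, only p = 2 (where both
-- orders are 1) violates these identities, so the error is 0 or −1, and it is eventually
-- below π(x)/m because there are infinitely many primes.

module Submission where

open import Defs
open import Data.Nat using (ℕ; _≤_; _*_; _<_; NonZero)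
open import Data.Integer using (∣_∣)
open import Data.Rational using (ℚ; Positive; 1ℚ)
open import Data.Product using (Σ; _×_)
open import Relation.Binary.PropositionalEquality using (_≢_)

open import Data.Bool using (true; false; T)
open import Data.Empty using (⊥; ⊥-elim)
open import Data.Fin using (Fin; toℕ; fromℕ<)
open import Data.Fin.Properties using (pigeonhole; toℕ-fromℕ<; toℕ<n)
open import Data.Integer as ℤ using (ℤ; +_; -[1+_]; _%ℕ_; _/ℕ_)
import Data.Integer.Properties as ℤP
open import Data.Integer.DivMod using (a≡a%ℕn+[a/ℕn]*n; n%ℕd<d)
open import Data.Integer.Divisibility.Signed as ℤ∣ using (divides) renaming (_∣_ to _∣ℤ_)
import Data.Integer.Tactic.RingSolver as ℤ-Solver
open import Data.List using ([]; _∷_; [_]; _++_; _∷ʳ_; length; filter; upTo; map)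
open import Data.List.Properties using (filter-≐; filter-++; length-++; map-cong; upTo-∷ʳ)
open import Data.List.Relation.Unary.All as All using (All; []; _∷_)
open import Data.List.Relation.Unary.All.Properties using (all-filter)
open import Data.List.Relation.Unary.AllPairs using ([]; _∷_)
open import Data.List.Relation.Unary.Unique.Propositional using (Unique)
open import Data.List.Relation.Unary.Unique.Propositional.Properties
  using (upTo⁺) renaming (filter⁺ to unique-filter⁺)
open import Data.Nat as ℕ
  using (zero; suc; _+_; _∸_; s≤s; s≤s⁻¹; z≤n; _≡ᵇ_; _%_; _/_; _!;
         nonTrivial⇒≢1; nonTrivial⇒n>1; ≢-nonZero⁻¹; >-nonZero⁻¹)
open import Data.Nat.Coprimality using (Coprime; coprime-divisor)
open import Data.Nat.DivMod using (m≡m%n+[m/n]*n; m%n<n; m*n%n≡0; [m+kn]%n≡m%n; m*n/n≡m)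
open import Data.Nat.Divisibility
  using (_∣_; _∣?_; divides; ∣-refl; ∣-trans; ∣-antisym; ∣⇒≤; 0∣⇒≡0; ∣1⇒≡1; ∣m+n∣m⇒∣n; n∣m*n;
         m∣m*n; ∣n⇒∣m*n; *-monoʳ-∣; *-cancelˡ-∣; m*n∣⇒m∣; m*n∣⇒n∣; m%n≡0⇒n∣m; n∣m⇒m%n≡0;
         ∣n∣m%n⇒∣m; m≤n⇒m!∣n!)
open import Data.Nat.ListAction using (sum; product)
open import Data.Nat.Primality using (Prime; prime?; euclidsLemma; prime⇒nonTrivial; prime⇒nonZero; prime[2])
open import Data.Nat.Primality.Factorisation using (factorise; PrimeFactorisation)
open import Data.Nat.Properties
  using (module ≤-Reasoning; +-comm; +-suc; +-identityʳ; *-comm; *-suc; ≤-refl; ≤-reflexive; ≤-trans;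
         ≤-antisym; <⇒≤; <⇒≱; ≮⇒≥; ≤∧≢⇒<; _<?_; n≤1+n; n<1+n; m≤m+n; m≤n⇒m<n∨m≡n; n≢0⇒n>0; ≡ᵇ⇒≡;
         *-monoʳ-≤; *-identityʳ; ∸-monoˡ-<; ∸-cancelʳ-≡; m<n⇒0<n∸m; m∸n+n≡m; +-∸-assoc; m+[n∸m]≡n;
         m∸n≤m; 1≤n!; +-commutativeSemigroup)
open import Algebra.Properties.CommutativeSemigroup +-commutativeSemigroup using (interchange)
import Data.Nat.Tactic.RingSolver as ℕ-Solver
open import Data.Product using (∃-syntax; _,_; proj₁; proj₂)
open import Data.Rational as ℚ using (↥_; ↧_; ↧ₙ_)
open import Data.Rational.Properties using (↥-neg; ↧-neg)
open import Data.Sum as Sum using (_⊎_; inj₁; inj₂; [_,_]′)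
open import Function.Base using (_∘_; id)
open import Function.Bundles using (_⇔_; mk⇔; Equivalence)
open import Function.Properties.Equivalence using () renaming (sym to ⇔-sym; trans to ⇔-trans)
open import Relation.Nullary using (¬_; Dec; yes; no)
open import Relation.Nullary.Decidable using (_×-dec_)
open import Relation.Unary using (Decidable)
open import Relation.Binary.PropositionalEquality
  using (_≡_; refl; subst; sym; trans; cong; cong₂; module ≡-Reasoning)

open Equivalence using (to; from)

-- Parity and the 2-adic valuation

data Parity : ℕ → Set where
  even : ∀ j → Parity (2 * j)
  odd  : ∀ j → Parity (1 + 2 * j)

parity : ∀ n → Parity n
parity zero = even 0
parity (suc n) with parity n
... | even j = odd j
... | odd j  = subst Parity (*-suc 2 j) (even (suc j))

data ν₂-View : ℕ → Set where
  ν₂≡0 : ∀ j → ν₂-View (1 + 2 * j)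
  ν₂≡1 : ∀ j → ν₂-View (2 * (1 + 2 * j))
  ν₂≥2 : ∀ w → ν₂-View (2 * (2 * w))

ν₂-view : ∀ n → ν₂-View n
ν₂-view n with parity n
... | odd j = ν₂≡0 j
... | even m with parity m
...   | odd j  = ν₂≡1 j
...   | even w = ν₂≥2 w

¬2∣1+2* : ∀ j → ¬ 2 ∣ 1 + 2 * j
¬2∣1+2* j 2∣1+2j with ∣1⇒≡1 (∣m+n∣m⇒∣n (subst (2 ∣_) (+-comm 1 (2 * j)) 2∣1+2j) (m∣m*n j))
... | ()

odd⇒coprime-2 : ∀ {e} → ¬ 2 ∣ e → Coprime e 2
odd⇒coprime-2 ¬2∣e {0} (_ , 0∣2) with 0∣⇒≡0 0∣2
... | ()
odd⇒coprime-2 ¬2∣e {1} _ = refl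
odd⇒coprime-2 ¬2∣e {2} (2∣e , _) = ⊥-elim (¬2∣e 2∣e)
odd⇒coprime-2 ¬2∣e {suc (suc (suc _))} (_ , i∣2) with ∣⇒≤ i∣2
... | s≤s (s≤s ())

odd-∣2*⇒∣ : ∀ {e m} → ¬ 2 ∣ e → e ∣ 2 * m → e ∣ m
odd-∣2*⇒∣ ¬2∣e = coprime-divisor (odd⇒coprime-2 ¬2∣e)

∣⇔2*∣2* : ∀ {e m} → (e ∣ m) ⇔ (2 * e ∣ 2 * m)
∣⇔2*∣2* = mk⇔ (*-monoʳ-∣ 2) (*-cancelˡ-∣ 2)

odd-∣2*⇔2*∣2* : ∀ {e m} → ¬ 2 ∣ e → (e ∣ 2 * m) ⇔ (2 * e ∣ 2 * m)
odd-∣2*⇔2*∣2* {e} {m} ¬2∣e = mk⇔ (*-monoʳ-∣ 2 ∘ odd-∣2*⇒∣ {m = m} ¬2∣e) (m*n∣⇒n∣ 2 e)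

-- The order of −x

-- NegatedOrder o o′: o′ is the order of −x when x has order o and −1 has order 2.
data NegatedOrder : ℕ → ℕ → Set where
  doubled   : ∀ j → NegatedOrder (1 + 2 * j) (2 * (1 + 2 * j))
  halved    : ∀ j → NegatedOrder (2 * (1 + 2 * j)) (1 + 2 * j)
  unchanged : ∀ w → NegatedOrder (2 * (2 * w)) (2 * (2 * w))

negatedOrder-sym : ∀ {o o′} → NegatedOrder o o′ → NegatedOrder o′ o
negatedOrder-sym (doubled j)   = halved j
negatedOrder-sym (halved j)    = doubled j
negatedOrder-sym (unchanged w) = unchanged w

-- The hypotheses hold for o = ord x and o′ = ord (−x): (−x)^k = x^k for even k,
-- (−x)^k = −x^k for odd k, and x^(2k) = 1 forces x^k = ±1 but not both.
negatedOrder : ∀ {o o′} →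
  (∀ k → (o′ ∣ 2 * k) ⇔ (o ∣ 2 * k)) →
  (∀ j → o ∣ 2 * (1 + 2 * j) → (o ∣ 1 + 2 * j) ⊎ (o′ ∣ 1 + 2 * j)) →
  (∀ j → o′ ∣ 1 + 2 * j → ¬ (o ∣ 1 + 2 * j)) →
  NegatedOrder o o′
negatedOrder {o} {o′} even-agree odd-split odd-exclusive
  with ν₂-view o | parity o′ | to (even-agree o′) (n∣m*n 2) | from (even-agree o) (n∣m*n 2)
... | ν₂≡0 j | even m | o∣2o′ | o′∣2o =
  subst (NegatedOrder o) (cong (2 *_) (∣-antisym o∣m m∣o)) (doubled j)
  where
  o∣m : o ∣ m
  o∣m = odd-∣2*⇒∣ (¬2∣1+2* j) (odd-∣2*⇒∣ (¬2∣1+2* j) o∣2o′)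
  m∣o : m ∣ o
  m∣o = *-cancelˡ-∣ 2 o′∣2o
... | ν₂≡0 j | odd i | o∣2o′ | _ = ⊥-elim (odd-exclusive i ∣-refl (odd-∣2*⇒∣ (¬2∣1+2* j) o∣2o′))
... | ν₂≡1 j | _ | o∣2o′ | _ = subst (NegatedOrder o) (∣-antisym (*-cancelˡ-∣ 2 o∣2o′) o′∣u) (halved j)
  where
  o′∣u : o′ ∣ 1 + 2 * j
  o′∣u with odd-split j ∣-refl
  ... | inj₁ 2u∣u = ⊥-elim (¬2∣1+2* j (m*n∣⇒m∣ 2 (1 + 2 * j) 2u∣u))
  ... | inj₂ o′∣u = o′∣u
... | ν₂≥2 w | even m | _ | _ =
  subst (NegatedOrder o) (∣-antisym (to (even-agree m) ∣-refl) (from (even-agree (2 * w)) ∣-refl)) (unchanged w)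
... | ν₂≥2 w | odd i | o∣2o′ | _ = ⊥-elim (¬2∣1+2* i (m*n∣⇒m∣ 2 w (*-cancelˡ-∣ 2 o∣2o′)))

NegationInvariant : ℕ → Set
NegationInvariant d = ∀ {o o′} → NegatedOrder o o′ → d ∣ o → d ∣ o′

odd⇒negationInvariant : ∀ {d} → ¬ 2 ∣ d → NegationInvariant d
odd⇒negationInvariant ¬2∣d (doubled j)   = ∣n⇒∣m*n 2
odd⇒negationInvariant ¬2∣d (halved j)    = odd-∣2*⇒∣ ¬2∣d
odd⇒negationInvariant ¬2∣d (unchanged w) = id

fourfold⇒negationInvariant : ∀ v → NegationInvariant (2 * (2 * v))
fourfold⇒negationInvariant v (doubled j) 4v∣o =
  ⊥-elim (¬2∣1+2* j (m*n∣⇒m∣ 2 (2 * v) 4v∣o))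
fourfold⇒negationInvariant v (halved j) 4v∣o =
  ⊥-elim (¬2∣1+2* j (m*n∣⇒m∣ 2 v (*-cancelˡ-∣ 2 4v∣o)))
fourfold⇒negationInvariant v (unchanged w) = id

negationInvariant⇒⇔ : ∀ {d o o′} → NegationInvariant d → NegatedOrder o o′ → (d ∣ o′) ⇔ (d ∣ o)
negationInvariant⇒⇔ invariant negated = mk⇔ (invariant (negatedOrder-sym negated)) (invariant negated)

χ : ∀ {A : Set} → Dec A → ℕ
χ (yes _) = 1
χ (no _)  = 0

χ-cong : ∀ {A B : Set} → A ⇔ B → (a? : Dec A) (b? : Dec B) → χ a? ≡ χ b?
χ-cong A⇔B (yes _) (yes _) = refl
χ-cong A⇔B (yes a) (no ¬b) = ⊥-elim (¬b (to A⇔B a))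
χ-cong A⇔B (no ¬a) (yes b) = ⊥-elim (¬a (from A⇔B b))
χ-cong A⇔B (no _)  (no _)  = refl

χ-yes : ∀ {A : Set} → A → (a? : Dec A) → χ a? ≡ 1
χ-yes a (yes _) = refl
χ-yes a (no ¬a) = ⊥-elim (¬a a)

χ-no : ∀ {A : Set} → ¬ A → (a? : Dec A) → χ a? ≡ 0
χ-no ¬a (yes a) = ⊥-elim (¬a a)
χ-no ¬a (no _)  = refl

χ-negatedOrder : ∀ {e o o′} → ¬ 2 ∣ e → NegatedOrder o o′ →
  χ (2 * e ∣? o′) + χ (2 * e ∣? o) ≡ χ (e ∣? o) + χ (2 * (2 * e) ∣? o)
χ-negatedOrder {e} ¬2∣e (doubled j) = cong₂ _+_
  (χ-cong (⇔-sym (∣⇔2*∣2* {e} {u})) (2 * e ∣? 2 * u) (e ∣? u))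
  (trans (χ-no (¬2∣1+2* j ∘ m*n∣⇒m∣ 2 e) (2 * e ∣? u))
         (sym (χ-no (¬2∣1+2* j ∘ m*n∣⇒m∣ 2 (2 * e)) (2 * (2 * e) ∣? u))))
  where u = 1 + 2 * j
χ-negatedOrder {e} ¬2∣e (halved j) = begin
  χ (2 * e ∣? u) + χ (2 * e ∣? 2 * u)
    ≡⟨ cong (_+ χ (2 * e ∣? 2 * u)) (χ-no (¬2∣1+2* j ∘ m*n∣⇒m∣ 2 e) (2 * e ∣? u)) ⟩
  χ (2 * e ∣? 2 * u)
    ≡⟨ χ-cong (⇔-sym (odd-∣2*⇔2*∣2* {m = u} ¬2∣e)) (2 * e ∣? 2 * u) (e ∣? 2 * u) ⟩
  χ (e ∣? 2 * u)
    ≡⟨ +-identityʳ _ ⟨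
  χ (e ∣? 2 * u) + 0
    ≡⟨ cong (_+_ (χ (e ∣? 2 * u)))
            (χ-no (¬2∣1+2* j ∘ m*n∣⇒m∣ 2 e ∘ *-cancelˡ-∣ 2) (2 * (2 * e) ∣? 2 * u)) ⟨
  χ (e ∣? 2 * u) + χ (2 * (2 * e) ∣? 2 * u) ∎
  where
  open ≡-Reasoning
  u = 1 + 2 * j
-- e ∣ 4w ⇔ 2e ∣ 4w, and 2e ∣ 4w ⇔ e ∣ 2w ⇔ 2e ∣ 2w ⇔ 4e ∣ 4w
χ-negatedOrder {e} ¬2∣e (unchanged w) = cong₂ _+_
  (χ-cong (⇔-sym (odd-∣2*⇔2*∣2* {m = 2 * w} ¬2∣e)) (2 * e ∣? o) (e ∣? o))
  (χ-cong (⇔-trans (⇔-sym (∣⇔2*∣2* {e} {2 * w})) (⇔-trans (odd-∣2*⇔2*∣2* {m = w} ¬2∣e) ∣⇔2*∣2*))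
          (2 * e ∣? o) (2 * (2 * e) ∣? o))
  where o = 2 * (2 * w)

-- Periods modulo a prime

-- n ^ k ≡ b ^ k (mod p), i.e. (n / b) ^ k ≡ 1 (mod p) without division.
Period : ℕ → ℤ → ℤ → ℕ → Set
Period p n b k = + p ∣ℤ n ℤ.^ k ℤ.- b ℤ.^ k

AntiPeriod : ℕ → ℤ → ℤ → ℕ → Set
AntiPeriod p n b k = + p ∣ℤ n ℤ.^ k ℤ.+ b ℤ.^ k

%ℕ-cong⇒∣ : ∀ {p} .{{_ : NonZero p}} (x y : ℤ) → x %ℕ p ≡ y %ℕ p → + p ∣ℤ x ℤ.- y
%ℕ-cong⇒∣ {p} x y x≡y = divides (x /ℕ p ℤ.- y /ℕ p) (begin
  x ℤ.- y
    ≡⟨ cong₂ ℤ._-_ (a≡a%ℕn+[a/ℕn]*n x p) (a≡a%ℕn+[a/ℕn]*n y p) ⟩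
  (+ (x %ℕ p) ℤ.+ x /ℕ p ℤ.* + p) ℤ.- (+ (y %ℕ p) ℤ.+ y /ℕ p ℤ.* + p)
    ≡⟨ cong (λ r → (+ (x %ℕ p) ℤ.+ x /ℕ p ℤ.* + p) ℤ.- (+ r ℤ.+ y /ℕ p ℤ.* + p)) (sym x≡y) ⟩
  (+ (x %ℕ p) ℤ.+ x /ℕ p ℤ.* + p) ℤ.- (+ (x %ℕ p) ℤ.+ y /ℕ p ℤ.* + p)
    ≡⟨ cancel (+ (x %ℕ p)) (x /ℕ p) (y /ℕ p) (+ p) ⟩
  (x /ℕ p ℤ.- y /ℕ p) ℤ.* + p ∎)
  where
  open ≡-Reasoning
  cancel : ∀ r s t P → (r ℤ.+ s ℤ.* P) ℤ.- (r ℤ.+ t ℤ.* P) ≡ (s ℤ.- t) ℤ.* P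
  cancel = ℤ-Solver.solve-∀

%ℕ≡0⇔∣ : ∀ {p} .{{_ : NonZero p}} (x : ℤ) → (x %ℕ p ≡ 0) ⇔ (+ p ∣ℤ x)
%ℕ≡0⇔∣ {p} x = mk⇔ %ℕ≡0⇒∣ (∣⇒%ℕ≡0 x)
  where
  %ℕ≡0⇒∣ : x %ℕ p ≡ 0 → + p ∣ℤ x
  %ℕ≡0⇒∣ x%p≡0 = divides (x /ℕ p) (begin
    x                             ≡⟨ a≡a%ℕn+[a/ℕn]*n x p ⟩
    + (x %ℕ p) ℤ.+ x /ℕ p ℤ.* + p ≡⟨ cong (λ r → + r ℤ.+ x /ℕ p ℤ.* + p) x%p≡0 ⟩
    + 0 ℤ.+ x /ℕ p ℤ.* + p        ≡⟨ ℤP.+-identityˡ _ ⟩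
    x /ℕ p ℤ.* + p                ∎)
    where open ≡-Reasoning
  ∣⇒%ℕ≡0 : ∀ x → + p ∣ℤ x → x %ℕ p ≡ 0
  ∣⇒%ℕ≡0 (+ n) p∣x = n∣m⇒m%n≡0 n p (ℤ∣.∣⇒∣ᵤ p∣x)
  ∣⇒%ℕ≡0 -[1+ n ] p∣x with suc n % p | n∣m⇒m%n≡0 (suc n) p (ℤ∣.∣⇒∣ᵤ p∣x)
  ... | .0 | refl = refl

module _ {p : ℕ} (p-prime : Prime p) where

  ℤ-euclid : ∀ x y → + p ∣ℤ x ℤ.* y → (+ p ∣ℤ x) ⊎ (+ p ∣ℤ y)
  ℤ-euclid x y p∣xy = Sum.map ℤ∣.∣ᵤ⇒∣ ℤ∣.∣ᵤ⇒∣
    (euclidsLemma ∣ x ∣ ∣ y ∣ p-prime (subst (p ∣_) (ℤP.abs-* x y) (ℤ∣.∣⇒∣ᵤ p∣xy)))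

  prime∤^ : ∀ {x} → ¬ (+ p ∣ℤ x) → ∀ k → ¬ (+ p ∣ℤ x ℤ.^ k)
  prime∤^ p∤x zero    p∣1   = nonTrivial⇒≢1 {{prime⇒nonTrivial p-prime}} (∣1⇒≡1 (ℤ∣.∣⇒∣ᵤ p∣1))
  prime∤^ p∤x (suc k) p∣xxᵏ = [ p∤x , prime∤^ p∤x k ]′ (ℤ-euclid _ _ p∣xxᵏ)

  prime∤* : ∀ {x y} → ¬ (+ p ∣ℤ x) → ¬ (+ p ∣ℤ y) → ¬ (+ p ∣ℤ x ℤ.* y)
  prime∤* p∤x p∤y p∣xy = [ p∤x , p∤y ]′ (ℤ-euclid _ _ p∣xy)

^-difference-+ : ∀ (n b : ℤ) i j →
  n ℤ.^ (i + j) ℤ.- b ℤ.^ (i + j)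
  ≡ n ℤ.^ i ℤ.* (n ℤ.^ j ℤ.- b ℤ.^ j) ℤ.+ b ℤ.^ j ℤ.* (n ℤ.^ i ℤ.- b ℤ.^ i)
^-difference-+ n b i j rewrite ℤP.^-distribˡ-+-* n i j | ℤP.^-distribˡ-+-* b i j =
  identity (n ℤ.^ i) (n ℤ.^ j) (b ℤ.^ i) (b ℤ.^ j)
  where
  identity : ∀ x u y v → x ℤ.* u ℤ.- y ℤ.* v ≡ x ℤ.* (u ℤ.- v) ℤ.+ v ℤ.* (x ℤ.- y)
  identity = ℤ-Solver.solve-∀

^-double : ∀ (x : ℤ) k → x ℤ.^ (2 * k) ≡ x ℤ.^ k ℤ.* x ℤ.^ k
^-double x k = trans (cong (λ m → x ℤ.^ (k + m)) (+-identityʳ k)) (ℤP.^-distribˡ-+-* x k k)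

^-difference-double : ∀ (n b : ℤ) k →
  n ℤ.^ (2 * k) ℤ.- b ℤ.^ (2 * k) ≡ (n ℤ.^ k ℤ.- b ℤ.^ k) ℤ.* (n ℤ.^ k ℤ.+ b ℤ.^ k)
^-difference-double n b k rewrite ^-double n k | ^-double b k = identity (n ℤ.^ k) (b ℤ.^ k)
  where
  identity : ∀ x y → x ℤ.* x ℤ.- y ℤ.* y ≡ (x ℤ.- y) ℤ.* (x ℤ.+ y)
  identity = ℤ-Solver.solve-∀

neg-^-even : ∀ (x : ℤ) k → (ℤ.- x) ℤ.^ (2 * k) ≡ x ℤ.^ (2 * k)
neg-^-even x k = begin
  (ℤ.- x) ℤ.^ (2 * k)   ≡⟨ ℤP.^-*-assoc (ℤ.- x) 2 k ⟨
  ((ℤ.- x) ℤ.^ 2) ℤ.^ k ≡⟨ cong (ℤ._^ k) (square-neg x) ⟩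
  (x ℤ.^ 2) ℤ.^ k       ≡⟨ ℤP.^-*-assoc x 2 k ⟩
  x ℤ.^ (2 * k)         ∎
  where
  open ≡-Reasoning
  square-neg : ∀ y → ℤ.- y ℤ.* (ℤ.- y ℤ.* ℤ.1ℤ) ≡ y ℤ.* (y ℤ.* ℤ.1ℤ)
  square-neg = ℤ-Solver.solve-∀

neg-^-odd : ∀ (x : ℤ) k → (ℤ.- x) ℤ.^ (1 + 2 * k) ≡ ℤ.- x ℤ.^ (1 + 2 * k)
neg-^-odd x k = trans (cong (ℤ.- x ℤ.*_) (neg-^-even x k)) (sym (ℤP.neg-distribˡ-* x _))

module _ {p : ℕ} {n b : ℤ} where

  period-0 : Period p n b 0
  period-0 = divides (+ 0) refl

  period-+ : ∀ i j → Period p n b i → Period p n b j → Period p n b (i + j)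
  period-+ i j p∣i p∣j = subst (+ p ∣ℤ_) (sym (^-difference-+ n b i j))
    (ℤ∣.∣m∣n⇒∣m+n (ℤ∣.∣n⇒∣m*n (n ℤ.^ i) p∣j) (ℤ∣.∣n⇒∣m*n (b ℤ.^ j) p∣i))

  period-neg-even : ∀ k → Period p (ℤ.- n) b (2 * k) ≡ Period p n b (2 * k)
  period-neg-even k = cong (λ x → + p ∣ℤ x ℤ.- b ℤ.^ (2 * k)) (neg-^-even n k)

  period-neg-odd : ∀ k → Period p (ℤ.- n) b (1 + 2 * k) ⇔ AntiPeriod p n b (1 + 2 * k)
  period-neg-odd k = mk⇔
    (λ h → subst (+ p ∣ℤ_) (ℤP.neg-involutive _) (ℤ∣.∣m⇒∣-m (subst (+ p ∣ℤ_) negated-sum h)))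
    (λ h → subst (+ p ∣ℤ_) (sym negated-sum) (ℤ∣.∣m⇒∣-m h))
    where
    u = 1 + 2 * k
    negated-sum : (ℤ.- n) ℤ.^ u ℤ.- b ℤ.^ u ≡ ℤ.- (n ℤ.^ u ℤ.+ b ℤ.^ u)
    negated-sum = trans (cong (ℤ._- b ℤ.^ u) (neg-^-odd n k)) (identity (n ℤ.^ u) (b ℤ.^ u))
      where
      identity : ∀ x y → ℤ.- x ℤ.- y ≡ ℤ.- (x ℤ.+ y)
      identity = ℤ-Solver.solve-∀

module _ {p : ℕ} (p-prime : Prime p) {n b : ℤ} (p∤n : ¬ (+ p ∣ℤ n)) (p∤b : ¬ (+ p ∣ℤ b)) where

  period-∸ : ∀ i j → Period p n b (i + j) → Period p n b i → Period p n b j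
  period-∸ i j p∣i+j p∣i = [ ⊥-elim ∘ prime∤^ p-prime p∤n i , id ]′ (ℤ-euclid p-prime (n ℤ.^ i) _
    (ℤ∣.∣m+n∣n⇒∣m (subst (+ p ∣ℤ_) (^-difference-+ n b i j) p∣i+j)
                  (ℤ∣.∣n⇒∣m*n (b ℤ.^ j) p∣i)))

  period-double : ∀ k → Period p n b (2 * k) → Period p n b k ⊎ AntiPeriod p n b k
  period-double k p∣2k = ℤ-euclid p-prime _ _ (subst (+ p ∣ℤ_) (^-difference-double n b k) p∣2k)

  ¬period×antiPeriod : p ≢ 2 → ∀ k → Period p n b k → AntiPeriod p n b k → ⊥
  ¬period×antiPeriod p≢2 k p∣n-b p∣n+b = [ p≢2 ∘ p∣2⇒p≡2 , prime∤^ p-prime p∤b k ]′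
    (ℤ-euclid p-prime (+ 2) (b ℤ.^ k)
      (subst (+ p ∣ℤ_) (identity (n ℤ.^ k) (b ℤ.^ k)) (ℤ∣.∣m∣n⇒∣m-n p∣n+b p∣n-b)))
    where
    identity : ∀ x y → (x ℤ.+ y) ℤ.- (x ℤ.- y) ≡ + 2 ℤ.* y
    identity = ℤ-Solver.solve-∀
    p∣2⇒p≡2 : + p ∣ℤ + 2 → p ≡ 2
    p∣2⇒p≡2 p∣2 = ≤-antisym (∣⇒≤ (ℤ∣.∣⇒∣ᵤ p∣2)) (nonTrivial⇒n>1 p {{prime⇒nonTrivial p-prime}})

-- The p values b^s n^(q-s), s ≤ q, have nonzero residues modulo p = q + 1, so two of them
-- coincide, and equal residues at s and s + k make k a period.
module _ {q : ℕ} (p-prime : Prime (suc q)) {n b : ℤ}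
         (p∤n : ¬ (+ suc q ∣ℤ n)) (p∤b : ¬ (+ suc q ∣ℤ b)) where

  private
    term : ℕ → ℕ → ℤ
    term s t = b ℤ.^ s ℤ.* n ℤ.^ t

    p∤term : ∀ s t → ¬ (+ suc q ∣ℤ term s t)
    p∤term s t = prime∤* p-prime (prime∤^ p-prime p∤b s) (prime∤^ p-prime p∤n t)

    residue : ℕ → ℕ
    residue s = term s (q ∸ s) %ℕ suc q

    residue>0 : ∀ s → 0 < residue s
    residue>0 s = n≢0⇒n>0 (p∤term s (q ∸ s) ∘ to (%ℕ≡0⇔∣ (term s (q ∸ s))))

    residue∸1<q : ∀ s → residue s ∸ 1 < q
    residue∸1<q s = ∸-monoˡ-< (n%ℕd<d (term s (q ∸ s)) (suc q)) (residue>0 s)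

    slot : Fin (suc q) → Fin q
    slot s = fromℕ< (residue∸1<q (toℕ s))

    term-difference : ∀ s t k → term s (t + k) ℤ.- term (s + k) t ≡ term s t ℤ.* (n ℤ.^ k ℤ.- b ℤ.^ k)
    term-difference s t k rewrite ℤP.^-distribˡ-+-* n t k | ℤP.^-distribˡ-+-* b s k =
      identity (b ℤ.^ s) (n ℤ.^ t) (n ℤ.^ k) (b ℤ.^ k)
      where
      identity : ∀ x u w v → x ℤ.* (u ℤ.* w) ℤ.- (x ℤ.* v) ℤ.* u ≡ (x ℤ.* u) ℤ.* (w ℤ.- v)
      identity = ℤ-Solver.solve-∀

    collision⇒period : ∀ {i j} → toℕ i < toℕ j → slot i ≡ slot j → Period (suc q) n b (toℕ j ∸ toℕ i)
    collision⇒period {i} {j} i<j slotᵢ≡slotⱼ = [ ⊥-elim ∘ p∤term I t , id ]′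
      (ℤ-euclid p-prime (term I t) _ (subst (+ suc q ∣ℤ_) (term-difference I t k) p∣difference))
      where
      I = toℕ i
      J = toℕ j
      t = q ∸ J
      k = J ∸ I
      residueᵢ≡residueⱼ : residue I ≡ residue J
      residueᵢ≡residueⱼ = ∸-cancelʳ-≡ (residue>0 I) (residue>0 J) (begin
        residue I ∸ 1 ≡⟨ toℕ-fromℕ< (residue∸1<q I) ⟨
        toℕ (slot i)  ≡⟨ cong toℕ slotᵢ≡slotⱼ ⟩
        toℕ (slot j)  ≡⟨ toℕ-fromℕ< (residue∸1<q J) ⟩
        residue J ∸ 1 ∎)
        where open ≡-Reasoning
      q∸I≡t+k : q ∸ I ≡ t + k
      q∸I≡t+k = trans (cong (_∸ I) (sym (m∸n+n≡m (s≤s⁻¹ (toℕ<n j))))) (+-∸-assoc t (<⇒≤ i<j))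
      p∣difference : + suc q ∣ℤ term I (t + k) ℤ.- term (I + k) t
      p∣difference = subst (+ suc q ∣ℤ_)
        (cong₂ (λ u v → term I u ℤ.- term v t) q∸I≡t+k (sym (m+[n∸m]≡n (<⇒≤ i<j))))
        (%ℕ-cong⇒∣ (term I (q ∸ I)) (term J t) residueᵢ≡residueⱼ)

  period-exists : ∃[ k ] 0 < k × k < suc q × Period (suc q) n b k
  period-exists with pigeonhole (n<1+n q) slot
  ... | i , j , i<j , slotᵢ≡slotⱼ =
    toℕ j ∸ toℕ i , m<n⇒0<n∸m i<j , s≤s (≤-trans (m∸n≤m (toℕ j) (toℕ i)) (s≤s⁻¹ (toℕ<n j))) ,
    collision⇒period i<j slotᵢ≡slotⱼ

-- The multiplicative order

record IsLeastFrom (P : ℕ → Set) (k s : ℕ) : Set where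
  field
    lower   : k ≤ s
    holds   : P s
    minimal : ∀ {i} → k ≤ i → i < s → ¬ P i

open IsLeastFrom

isLeastFrom-⇔ : ∀ {P Q : ℕ → Set} {k s} → (∀ i → P i ⇔ Q i) → IsLeastFrom P k s → IsLeastFrom Q k s
isLeastFrom-⇔ P⇔Q least = record
  { lower   = lower least
  ; holds   = to (P⇔Q _) (holds least)
  ; minimal = λ k≤i i<s → minimal least k≤i i<s ∘ from (P⇔Q _)
  }

isLeastFrom-pred : ∀ {P : ℕ → Set} {k s} → ¬ P k → IsLeastFrom P (suc k) s → IsLeastFrom P k s
isLeastFrom-pred {P} {k} {s} ¬Pk least = record
  { lower   = ≤-trans (n≤1+n k) (lower least)
  ; holds   = holds least
  ; minimal = minimal′
  }
  where
  minimal′ : ∀ {i} → k ≤ i → i < s → ¬ P i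
  minimal′ k≤i i<s with m≤n⇒m<n∨m≡n k≤i
  ... | inj₁ k<i  = minimal least k<i i<s
  ... | inj₂ refl = ¬Pk

module _ {P : ℕ → Set} (P-0 : P 0)
         (P-+ : ∀ i j → P i → P j → P (i + j))
         (P-∸ : ∀ i j → P (i + j) → P i → P j) where

  P-* : ∀ {o} → P o → ∀ m → P (m * o)
  P-* Po zero          = P-0
  P-* {o} Po (suc m) = P-+ o (m * o) Po (P-* Po m)

  leastPositive-∣⇔ : ∀ {o} → IsLeastFrom P 1 o → ∀ k → P k ⇔ o ∣ k
  leastPositive-∣⇔ {o@(suc _)} least k = mk⇔ Pk⇒o∣k (λ { (divides m refl) → P-* (holds least) m })
    where
    Pk⇒o∣k : P k → o ∣ k
    Pk⇒o∣k Pk with k % o in k%o≡r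
                 | P-∸ ((k / o) * o) (k % o)
                       (subst P (trans (m≡m%n+[m/n]*n k o) (+-comm (k % o) _)) Pk) (P-* (holds least) (k / o))
    ... | zero  | _  = m%n≡0⇒n∣m k o k%o≡r
    ... | suc r | Pr = ⊥-elim (minimal least (s≤s z≤n) (subst (_< o) k%o≡r (m%n<n k o)) Pr)

search-isLeastFrom : ∀ a q f k {j} → k ≤ j → j < k + f → isOne a q j ≡ true →
  IsLeastFrom (λ i → isOne a q i ≡ true) k (search a q f k)
search-isLeastFrom a q zero k k≤j j<k+0 _ = ⊥-elim (<⇒≱ (subst (_ <_) (+-identityʳ k) j<k+0) k≤j)
search-isLeastFrom a q (suc f) k {j} k≤j j<k+1+f hitⱼ with isOne a q k in missₖ
... | true  = record { lower = ≤-refl ; holds = missₖ ; minimal = λ k≤i i<k → ⊥-elim (<⇒≱ i<k k≤i) }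
... | false = isLeastFrom-pred ¬hitₖ
  (search-isLeastFrom a q f (suc k) (≤∧≢⇒< k≤j k≢j) (subst (j <_) (+-suc k f) j<k+1+f) hitⱼ)
  where
  ¬hitₖ : ¬ (isOne a q k ≡ true)
  ¬hitₖ hitₖ with trans (sym hitₖ) missₖ
  ... | ()
  k≢j : k ≢ j
  k≢j refl = ¬hitₖ hitⱼ

isOne⇔period : ∀ a q k → (isOne a q k ≡ true) ⇔ Period (suc q) (↥ a) (↧ a) k
isOne⇔period a q k = ⇔-trans ≡ᵇ0⇔≡0 (%ℕ≡0⇔∣ _)
  where
  ≡ᵇ0⇔≡0 : ∀ {m} → ((m ≡ᵇ 0) ≡ true) ⇔ (m ≡ 0)
  ≡ᵇ0⇔≡0 {zero}  = mk⇔ (λ _ → refl) (λ _ → refl)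
  ≡ᵇ0⇔≡0 {suc m} = mk⇔ (λ ()) (λ ())

valuationZero⇒∤↥ : ∀ a {p} → ValuationZero a p → ¬ (+ p ∣ℤ ↥ a)
valuationZero⇒∤↥ a (p∤n , _) = p∤n ∘ ℤ∣.∣⇒∣ᵤ

valuationZero⇒∤↧ : ∀ a {p} → ValuationZero a p → ¬ (+ p ∣ℤ ↧ a)
valuationZero⇒∤↧ a (_ , p∤b) = p∤b ∘ ℤ∣.∣⇒∣ᵤ

ord-isLeastFrom : ∀ {q} a → Prime (suc q) → ValuationZero a (suc q) →
  IsLeastFrom (Period (suc q) (↥ a) (↧ a)) 1 (ord a (suc q))
ord-isLeastFrom {q} a p-prime vz =
  found (period-exists p-prime (valuationZero⇒∤↥ a vz) (valuationZero⇒∤↧ a vz))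
  where
  found : ∃[ k ] 0 < k × k < suc q × Period (suc q) (↥ a) (↧ a) k →
          IsLeastFrom (Period (suc q) (↥ a) (↧ a)) 1 (search a q (suc q) 1)
  found (k , 0<k , k<p , period-k) = isLeastFrom-⇔ (isOne⇔period a q)
    (search-isLeastFrom a q (suc q) 1 0<k (≤-trans k<p (n≤1+n _)) (from (isOne⇔period a q k) period-k))

ord-∣⇔ : ∀ {p} a → Prime p → ValuationZero a p → ∀ k → Period p (↥ a) (↧ a) k ⇔ ord a p ∣ k
ord-∣⇔ {zero}  a p-prime = ⊥-elim (≢-nonZero⁻¹ 0 {{prime⇒nonZero p-prime}} refl)
ord-∣⇔ {suc q} a p-prime vz =
  leastPositive-∣⇔ {P = Period (suc q) (↥ a) (↧ a)} (period-0 {suc q} {↥ a} {↧ a}) period-+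
    (period-∸ p-prime (valuationZero⇒∤↥ a vz) (valuationZero⇒∤↧ a vz)) (ord-isLeastFrom a p-prime vz)

ord[2]≡1 : ∀ a → ValuationZero a 2 → ord a 2 ≡ 1
ord[2]≡1 a vz =
  period-1⇒ord≡1 (period-exists prime[2] (valuationZero⇒∤↥ a vz) (valuationZero⇒∤↧ a vz))
  where
  period-1⇒ord≡1 : ∃[ k ] 0 < k × k < 2 × Period 2 (↥ a) (↧ a) k → ord a 2 ≡ 1
  period-1⇒ord≡1 (1 , _ , _ , period-1) = ∣1⇒≡1 (to (ord-∣⇔ a prime[2] vz 1) period-1)
  period-1⇒ord≡1 (suc (suc _) , _ , s≤s (s≤s ()) , _)

∣↥-neg∣ : ∀ a → ∣ ↥ (ℚ.- a) ∣ ≡ ∣ ↥ a ∣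
∣↥-neg∣ a = trans (cong ∣_∣ (↥-neg a)) (ℤP.∣-i∣≡∣i∣ (↥ a))

↧ₙ-neg : ∀ a → ↧ₙ (ℚ.- a) ≡ ↧ₙ a
↧ₙ-neg a = cong ∣_∣ (↧-neg a)

valuationZero-neg : ∀ a {p} → ValuationZero a p → ValuationZero (ℚ.- a) p
valuationZero-neg a {p} (p∤n , p∤b) =
  p∤n ∘ subst (p ∣_) (∣↥-neg∣ a) , p∤b ∘ subst (p ∣_) (↧ₙ-neg a)

valuationZero-neg⁻¹ : ∀ a {p} → ValuationZero (ℚ.- a) p → ValuationZero a p
valuationZero-neg⁻¹ a {p} (p∤n , p∤b) =
  p∤n ∘ subst (p ∣_) (sym (∣↥-neg∣ a)) , p∤b ∘ subst (p ∣_) (sym (↧ₙ-neg a))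

ord-negatedOrder : ∀ {p} g → Prime p → p ≢ 2 → ValuationZero g p → NegatedOrder (ord g p) (ord (ℚ.- g) p)
ord-negatedOrder {p} g p-prime p≢2 vz = negatedOrder even-agree odd-split odd-exclusive
  where
  n = ↥ g
  b = ↧ g
  p∤n = valuationZero⇒∤↥ g vz
  p∤b = valuationZero⇒∤↧ g vz
  o = ord g p
  o′ = ord (ℚ.- g) p
  o-∣⇔ : ∀ k → Period p n b k ⇔ o ∣ k
  o-∣⇔ = ord-∣⇔ g p-prime vz
  o′-∣⇔ : ∀ k → Period p (ℤ.- n) b k ⇔ o′ ∣ k
  o′-∣⇔ k = subst (λ n′ → Period p n′ b k ⇔ o′ ∣ k) (↥-neg g)
    (subst (λ b′ → Period p (↥ (ℚ.- g)) b′ k ⇔ o′ ∣ k) (↧-neg g)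
      (ord-∣⇔ (ℚ.- g) p-prime (valuationZero-neg g vz) k))
  even-agree : ∀ k → (o′ ∣ 2 * k) ⇔ (o ∣ 2 * k)
  even-agree k = ⇔-trans (⇔-sym (o′-∣⇔ (2 * k)))
    (subst (_⇔ o ∣ 2 * k) (sym (period-neg-even {p} {n} {b} k)) (o-∣⇔ (2 * k)))
  odd-split : ∀ j → o ∣ 2 * (1 + 2 * j) → (o ∣ 1 + 2 * j) ⊎ (o′ ∣ 1 + 2 * j)
  odd-split j o∣2u = Sum.map (to (o-∣⇔ _)) (to (o′-∣⇔ _) ∘ from (period-neg-odd {p} {n} {b} j))
    (period-double p-prime p∤n p∤b (1 + 2 * j) (from (o-∣⇔ _) o∣2u))
  odd-exclusive : ∀ j → o′ ∣ 1 + 2 * j → ¬ (o ∣ 1 + 2 * j)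
  odd-exclusive j o′∣u o∣u = ¬period×antiPeriod p-prime p∤n p∤b p≢2 (1 + 2 * j)
    (from (o-∣⇔ _) o∣u) (to (period-neg-odd {p} {n} {b} j) (from (o′-∣⇔ _) o′∣u))

ord-neg-∣⇔ : ∀ {p d} g → Prime p → ValuationZero g p → NegationInvariant d →
  (d ∣ ord (ℚ.- g) p) ⇔ (d ∣ ord g p)
ord-neg-∣⇔ {p} {d} g p-prime vz invariant with p ℕ.≟ 2
... | yes refl = subst (λ o → (d ∣ o) ⇔ (d ∣ ord g 2))
  (trans (ord[2]≡1 g vz) (sym (ord[2]≡1 (ℚ.- g) (valuationZero-neg g vz)))) (mk⇔ id id)
... | no p≢2 = negationInvariant⇒⇔ invariant (ord-negatedOrder g p-prime p≢2 vz)

-- Counting primes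

length-filter≡sum-χ : ∀ {P : ℕ → Set} (P? : Decidable P) xs → length (filter P? xs) ≡ sum (map (χ ∘ P?) xs)
length-filter≡sum-χ P? [] = refl
length-filter≡sum-χ P? (x ∷ xs) with P? x
... | yes _ = cong suc (length-filter≡sum-χ P? xs)
... | no _  = length-filter≡sum-χ P? xs

sum-map-+ : ∀ (f g : ℕ → ℕ) xs → sum (map (λ x → f x + g x) xs) ≡ sum (map f xs) + sum (map g xs)
sum-map-+ f g [] = refl
sum-map-+ f g (x ∷ xs) = trans (cong (_+_ (f x + g x)) (sum-map-+ f g xs)) (interchange (f x) (g x) _ _)

unique-≡-length≤1 : ∀ {c : ℕ} {xs} → Unique xs → All (_≡ c) xs → length xs ≤ 1
unique-≡-length≤1 [] [] = z≤n
unique-≡-length≤1 (_ ∷ _) (_ ∷ []) = ≤-refl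
unique-≡-length≤1 ((x≢y ∷ _) ∷ _) (x≡c ∷ y≡c ∷ _) = ⊥-elim (x≢y (trans x≡c (sym y≡c)))

counted-neg⇔ : ∀ g {d} → NegationInvariant d → ∀ p → Counted (ℚ.- g) d p ⇔ Counted g d p
counted-neg⇔ g invariant p = mk⇔
  (λ (p-prime , vz′ , d∣o′) → let vz = valuationZero-neg⁻¹ g vz′ in
    p-prime , vz , to (ord-neg-∣⇔ g p-prime vz invariant) d∣o′)
  (λ (p-prime , vz , d∣o) →
    p-prime , valuationZero-neg g vz , from (ord-neg-∣⇔ g p-prime vz invariant) d∣o)

N-neg-invariant : ∀ g {d} → NegationInvariant d → ∀ x → N (ℚ.- g) d x ≡ N g d x
N-neg-invariant g {d} invariant x = cong length
  (filter-≐ (counted? (ℚ.- g) d) (counted? g d)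
    (to (counted-neg⇔ g invariant _) , from (counted-neg⇔ g invariant _)) (upTo (suc x)))

χ-counted : ∀ a d p → Prime p → ValuationZero a p → χ (counted? a d p) ≡ χ (d ∣? ord a p)
χ-counted a d p p-prime vz =
  χ-cong (mk⇔ (proj₂ ∘ proj₂) (λ d∣o → p-prime , vz , d∣o)) (counted? a d p) (d ∣? ord a p)

χ-uncounted : ∀ a d p → ¬ (Prime p × ValuationZero a p) → χ (counted? a d p) ≡ 0
χ-uncounted a d p ¬pv = χ-no (λ (p-prime , vz , _) → ¬pv (p-prime , vz)) (counted? a d p)

¬counted-even-at-2 : ∀ a {p d} → p ≡ 2 → ValuationZero a p → 2 ∣ d → ¬ Counted a d p
¬counted-even-at-2 a refl vz 2∣d (_ , _ , d∣o) = 2≢1 (∣1⇒≡1 (∣-trans 2∣d (subst (_ ∣_) (ord[2]≡1 a vz) d∣o)))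
  where
  2≢1 : 2 ≢ 1
  2≢1 ()

-- The prime 2 is the only one at which the identity for d = 2e, e odd, can fail.
counted-at-2? : (g : ℚ) (e p : ℕ) → Dec (p ≡ 2 × Counted g e p)
counted-at-2? g e p = (p ℕ.≟ 2) ×-dec counted? g e p

module TwiceOdd (g : ℚ) {e : ℕ} (¬2∣e : ¬ 2 ∣ e) where

  TwiceOddIdentity : ℕ → Set
  TwiceOddIdentity p =
    χ (counted? (ℚ.- g) (2 * e) p) + χ (counted? g (2 * e) p) + χ (counted-at-2? g e p)
    ≡ χ (counted? g e p) + χ (counted? g (2 * (2 * e)) p)

  identity-uncounted : ∀ {p} → ¬ (Prime p × ValuationZero g p) → TwiceOddIdentity p
  identity-uncounted {p} ¬pv
    rewrite χ-uncounted (ℚ.- g) (2 * e) p (λ (p-prime , vz′) → ¬pv (p-prime , valuationZero-neg⁻¹ g vz′))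
          | χ-uncounted g (2 * e) p ¬pv
          | χ-no (λ (_ , p-prime , vz , _) → ¬pv (p-prime , vz)) (counted-at-2? g e p)
          | χ-uncounted g e p ¬pv
          | χ-uncounted g (2 * (2 * e)) p ¬pv = refl

  identity-odd : ∀ {p} → Prime p → p ≢ 2 → ValuationZero g p → TwiceOddIdentity p
  identity-odd {p} p-prime p≢2 vz
    rewrite χ-counted (ℚ.- g) (2 * e) p p-prime (valuationZero-neg g vz)
          | χ-counted g (2 * e) p p-prime vz
          | χ-no (p≢2 ∘ proj₁) (counted-at-2? g e p)
          | χ-counted g e p p-prime vz
          | χ-counted g (2 * (2 * e)) p p-prime vz
    = trans (+-identityʳ _) (χ-negatedOrder ¬2∣e (ord-negatedOrder g p-prime p≢2 vz))

  identity-2 : ∀ {p} → p ≡ 2 → ValuationZero g p → TwiceOddIdentity p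
  identity-2 {p} p≡2 vz
    rewrite χ-no (¬counted-even-at-2 (ℚ.- g) p≡2 (valuationZero-neg g vz) (m∣m*n e)) (counted? (ℚ.- g) (2 * e) p)
          | χ-no (¬counted-even-at-2 g p≡2 vz (m∣m*n e)) (counted? g (2 * e) p)
          | χ-no (¬counted-even-at-2 g p≡2 vz (m∣m*n (2 * e))) (counted? g (2 * (2 * e)) p)
    = trans (χ-cong (mk⇔ proj₂ (p≡2 ,_)) (counted-at-2? g e p) (counted? g e p)) (sym (+-identityʳ _))

  twiceOddIdentity : ∀ p → TwiceOddIdentity p
  twiceOddIdentity p = atPrime (prime? p ×-dec valuationZero? g p) (p ℕ.≟ 2)
    where
    atPrime : Dec (Prime p × ValuationZero g p) → Dec (p ≡ 2) → TwiceOddIdentity p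
    atPrime (no ¬pv)             _         = identity-uncounted ¬pv
    atPrime (yes (_ , vz))       (yes p≡2) = identity-2 p≡2 vz
    atPrime (yes (p-prime , vz)) (no p≢2)  = identity-odd p-prime p≢2 vz

N-neg-twiceOdd : ∀ g {e} → ¬ 2 ∣ e → ∀ x →
  N (ℚ.- g) (2 * e) x + N g (2 * e) x + length (filter (counted-at-2? g e) (upTo (suc x)))
  ≡ N g e x + N g (2 * (2 * e)) x
N-neg-twiceOdd g {e} ¬2∣e x = begin
  length (filter A? xs) + length (filter B? xs) + length (filter C? xs)
    ≡⟨ cong₂ _+_ (cong₂ _+_ (length-filter≡sum-χ A? xs) (length-filter≡sum-χ B? xs))
                 (length-filter≡sum-χ C? xs) ⟩
  ∑ (χ ∘ A?) + ∑ (χ ∘ B?) + ∑ (χ ∘ C?)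
    ≡⟨ cong (_+ ∑ (χ ∘ C?)) (sum-map-+ (χ ∘ A?) (χ ∘ B?) xs) ⟨
  ∑ (λ p → χ (A? p) + χ (B? p)) + ∑ (χ ∘ C?)
    ≡⟨ sum-map-+ (λ p → χ (A? p) + χ (B? p)) (χ ∘ C?) xs ⟨
  ∑ (λ p → χ (A? p) + χ (B? p) + χ (C? p))
    ≡⟨ cong sum (map-cong (TwiceOdd.twiceOddIdentity g ¬2∣e) xs) ⟩
  ∑ (λ p → χ (D? p) + χ (E? p))
    ≡⟨ sum-map-+ (χ ∘ D?) (χ ∘ E?) xs ⟩
  ∑ (χ ∘ D?) + ∑ (χ ∘ E?)
    ≡⟨ cong₂ _+_ (length-filter≡sum-χ D? xs) (length-filter≡sum-χ E? xs) ⟨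
  length (filter D? xs) + length (filter E? xs) ∎
  where
  open ≡-Reasoning
  xs = upTo (suc x)
  ∑ : (ℕ → ℕ) → ℕ
  ∑ f = sum (map f xs)
  A? = counted? (ℚ.- g) (2 * e)
  B? = counted? g (2 * e)
  C? = counted-at-2? g e
  D? = counted? g e
  E? = counted? g (2 * (2 * e))

counted-at-2-count≤1 : ∀ g e x → length (filter (counted-at-2? g e) (upTo (suc x))) ≤ 1
counted-at-2-count≤1 g e x = unique-≡-length≤1 (unique-filter⁺ (counted-at-2? g e) (upTo⁺ (suc x)))
  (All.map proj₁ (all-filter (counted-at-2? g e) (upTo (suc x))))

-- The error term

≢⇒≡ᵇ-false : ∀ {m n} → m ≢ n → (m ≡ᵇ n) ≡ false
≢⇒≡ᵇ-false {m} {n} m≢n with m ≡ᵇ n in m≡ᵇn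
... | false = refl
... | true  = ⊥-elim (m≢n (≡ᵇ⇒≡ m n (subst T (sym m≡ᵇn) _)))

RHS-≢2 : ∀ g d x → d % 4 ≢ 2 → RHS g d x ≡ + N g d x
RHS-≢2 g d x d%4≢2 rewrite ≢⇒≡ᵇ-false d%4≢2 = refl

RHS-≡2 : ∀ g d x → d % 4 ≡ 2 → RHS g d x ≡ + N g (d / 2) x ℤ.+ + N g (2 * d) x ℤ.- + N g d x
RHS-≡2 g d x d%4≡2 rewrite d%4≡2 = refl

odd%4≢2 : ∀ j → (1 + 2 * j) % 4 ≢ 2
odd%4≢2 j d%4≡2 = ¬2∣1+2* j (∣n∣m%n⇒∣m (divides 2 refl) (subst (2 ∣_) (sym d%4≡2) (divides 1 refl)))

fourfold%4≢2 : ∀ w → (2 * (2 * w)) % 4 ≢ 2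
fourfold%4≢2 w d%4≡2 with trans (sym (trans (cong (_% 4) (identity w)) (m*n%n≡0 w 4))) d%4≡2
  where
  identity : ∀ w → 2 * (2 * w) ≡ w * 4
  identity = ℕ-Solver.solve-∀
... | ()

twiceOdd%4≡2 : ∀ j → (2 * (1 + 2 * j)) % 4 ≡ 2
twiceOdd%4≡2 j = trans (cong (_% 4) (identity j)) ([m+kn]%n≡m%n 2 j 4)
  where
  identity : ∀ j → 2 * (1 + 2 * j) ≡ 2 + j * 4
  identity = ℕ-Solver.solve-∀

Err-invariant : ∀ g {d} → NegationInvariant d → d % 4 ≢ 2 → ∀ x → Err g d x ≡ + 0
Err-invariant g {d} invariant d%4≢2 x = begin
  + N (ℚ.- g) d x ℤ.- RHS g d x
    ≡⟨ cong₂ ℤ._-_ (cong +_ (N-neg-invariant g invariant x)) (RHS-≢2 g d x d%4≢2) ⟩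
  + N g d x ℤ.- + N g d x
    ≡⟨ ℤP.+-inverseʳ (+ N g d x) ⟩
  + 0 ∎
  where open ≡-Reasoning

pos-difference : ∀ a b c f k → a + c + k ≡ b + f → + a ℤ.- (+ b ℤ.+ + f ℤ.- + c) ≡ ℤ.- + k
pos-difference a b c f k a+c+k≡b+f = begin
  + a ℤ.- (+ b ℤ.+ + f ℤ.- + c)         ≡⟨ cong (λ z → + a ℤ.- (z ℤ.- + c)) (ℤP.pos-+ b f) ⟨
  + a ℤ.- (+ (b + f) ℤ.- + c)           ≡⟨ cong (λ z → + a ℤ.- (+ z ℤ.- + c)) a+c+k≡b+f ⟨
  + a ℤ.- (+ (a + c + k) ℤ.- + c)       ≡⟨ cong (λ z → + a ℤ.- (z ℤ.- + c)) pos-a+c+k ⟩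
  + a ℤ.- (+ a ℤ.+ + c ℤ.+ + k ℤ.- + c) ≡⟨ identity (+ a) (+ c) (+ k) ⟩
  ℤ.- + k                               ∎
  where
  open ≡-Reasoning
  pos-a+c+k : + (a + c + k) ≡ + a ℤ.+ + c ℤ.+ + k
  pos-a+c+k = trans (ℤP.pos-+ (a + c) k) (cong (ℤ._+ + k) (ℤP.pos-+ a c))
  identity : ∀ a c k → a ℤ.- (a ℤ.+ c ℤ.+ k ℤ.- c) ≡ ℤ.- k
  identity = ℤ-Solver.solve-∀

Err-twiceOdd : ∀ g j x →
  Err g (2 * (1 + 2 * j)) x ≡ ℤ.- + length (filter (counted-at-2? g (1 + 2 * j)) (upTo (suc x)))
Err-twiceOdd g j x = begin
  + N (ℚ.- g) d x ℤ.- RHS g d x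
    ≡⟨ cong (ℤ._-_ (+ N (ℚ.- g) d x)) (RHS-≡2 g d x (twiceOdd%4≡2 j)) ⟩
  + N (ℚ.- g) d x ℤ.- (+ N g (d / 2) x ℤ.+ + N g (2 * d) x ℤ.- + N g d x)
    ≡⟨ cong (λ e → + N (ℚ.- g) d x ℤ.- (+ N g e x ℤ.+ + N g (2 * d) x ℤ.- + N g d x)) d/2≡u ⟩
  + N (ℚ.- g) d x ℤ.- (+ N g u x ℤ.+ + N g (2 * d) x ℤ.- + N g d x)
    ≡⟨ pos-difference (N (ℚ.- g) d x) (N g u x) (N g d x) (N g (2 * d) x) _ (N-neg-twiceOdd g (¬2∣1+2* j) x) ⟩
  ℤ.- + length (filter (counted-at-2? g u) (upTo (suc x))) ∎
  where
  open ≡-Reasoning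
  u = 1 + 2 * j
  d = 2 * u
  d/2≡u : d / 2 ≡ u
  d/2≡u = trans (cong (_/ 2) (*-comm 2 u)) (m*n/n≡m u 2)

∣Err∣≤1 : ∀ g d x → ∣ Err g d x ∣ ≤ 1
∣Err∣≤1 g d x with ν₂-view d
... | ν₂≡0 j = subst (λ z → ∣ z ∣ ≤ 1)
  (sym (Err-invariant g (odd⇒negationInvariant (¬2∣1+2* j)) (odd%4≢2 j) x)) z≤n
... | ν₂≥2 w = subst (λ z → ∣ z ∣ ≤ 1)
  (sym (Err-invariant g (fourfold⇒negationInvariant w) (fourfold%4≢2 w) x)) z≤n
... | ν₂≡1 j = subst (λ z → ∣ z ∣ ≤ 1) (sym (Err-twiceOdd g j x))
  (subst (_≤ 1) (sym (ℤP.∣-i∣≡∣i∣ (+ _))) (counted-at-2-count≤1 g (1 + 2 * j) x))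

-- Infinitely many primes

primeCount-suc : ∀ x → primeCount (suc x) ≡ primeCount x + χ (prime? (suc x))
primeCount-suc x = begin
  length (filter prime? (upTo (suc (suc x))))
    ≡⟨ cong (length ∘ filter prime?) (upTo-∷ʳ (suc x)) ⟨
  length (filter prime? (upTo (suc x) ∷ʳ suc x))
    ≡⟨ cong length (filter-++ prime? (upTo (suc x)) [ suc x ]) ⟩
  length (filter prime? (upTo (suc x)) ++ filter prime? [ suc x ])
    ≡⟨ length-++ (filter prime? (upTo (suc x))) ⟩
  primeCount x + length (filter prime? [ suc x ])
    ≡⟨ cong (_+_ (primeCount x)) (trans (length-filter≡sum-χ prime? [ suc x ]) (+-identityʳ _)) ⟩
  primeCount x + χ (prime? (suc x)) ∎
  where open ≡-Reasoning

primeCount-mono : ∀ {x y} → x ≤ y → primeCount x ≤ primeCount y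
primeCount-mono {y = zero} z≤n = ≤-refl
primeCount-mono {x} {suc y} x≤1+y with m≤n⇒m<n∨m≡n x≤1+y
... | inj₂ refl       = ≤-refl
... | inj₁ (s≤s x≤y) = ≤-trans (primeCount-mono x≤y)
  (subst (primeCount y ≤_) (sym (primeCount-suc y)) (m≤m+n _ _))

∣n! : ∀ {p n} → 0 < p → p ≤ n → p ∣ n !
∣n! {suc k} _ p≤n = ∣-trans (m∣m*n (k !)) (m≤n⇒m!∣n! p≤n)

prime>n : ∀ n → ∃[ p ] Prime p × n < p
prime>n n = primeFactor> (factors F) (isFactorisation F) (factorsPrime F)
  where
  open PrimeFactorisation
  F = factorise (suc (n !))
  primeFactor> : ∀ ps → suc (n !) ≡ product ps → All Prime ps → ∃[ p ] Prime p × n < p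
  primeFactor> [] n!+1≡1 [] = ⊥-elim (<⇒≱ (s≤s (1≤n! n)) (≤-reflexive n!+1≡1))
  primeFactor> (p ∷ ps) n!+1≡p*ps (p-prime ∷ _) with n <? p
  ... | yes n<p = p , p-prime , n<p
  ... | no  n≮p = ⊥-elim (nonTrivial⇒≢1 {{prime⇒nonTrivial p-prime}} (∣1⇒≡1 p∣1))
    where
    p∣n!+1 : p ∣ n ! + 1
    p∣n!+1 = subst (p ∣_) (trans (sym n!+1≡p*ps) (+-comm 1 (n !))) (m∣m*n (product ps))
    p∣1 : p ∣ 1
    p∣1 = ∣m+n∣m⇒∣n p∣n!+1 (∣n! (>-nonZero⁻¹ p {{prime⇒nonZero p-prime}}) (≮⇒≥ n≮p))

primeCount-unbounded : ∀ m → ∃[ X ] m ≤ primeCount X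
primeCount-unbounded zero    = 0 , z≤n
primeCount-unbounded (suc m) with primeCount-unbounded m
... | X , m≤πX with prime>n X
...   | suc p , p-prime , s≤s X≤p = suc p , (begin
  suc m                             ≤⟨ s≤s (≤-trans m≤πX (primeCount-mono X≤p)) ⟩
  suc (primeCount p)                ≡⟨ +-comm 1 (primeCount p) ⟩
  primeCount p + 1                  ≡⟨ cong (_+_ (primeCount p)) (χ-yes p-prime (prime? (suc p))) ⟨
  primeCount p + χ (prime? (suc p)) ≡⟨ primeCount-suc p ⟨
  primeCount (suc p)                ∎)
  where open ≤-Reasoning

lemma7 : (g : ℚ) → Positive g → g ≢ 1ℚ → (d : ℕ) → 0 < d →
    Σ ℕ (λ C → (x : ℕ) → ∣ Err g d x ∣ ≤ C)
    × ((m : ℕ) → 0 < m → Σ ℕ (λ X → (x : ℕ) → X ≤ x → m * ∣ Err g d x ∣ ≤ primeCount x))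
lemma7 g _ _ d _ = (1 , ∣Err∣≤1 g d) , λ m _ → eventually m (primeCount-unbounded m)
  where
  eventually : ∀ m → ∃[ X ] m ≤ primeCount X →
               Σ ℕ (λ X → (x : ℕ) → X ≤ x → m * ∣ Err g d x ∣ ≤ primeCount x)
  eventually m (X , m≤πX) = X , λ x X≤x → begin
    m * ∣ Err g d x ∣ ≤⟨ *-monoʳ-≤ m (∣Err∣≤1 g d x) ⟩
    m * 1             ≡⟨ *-identityʳ m ⟩
    m                 ≤⟨ m≤πX ⟩
    primeCount X      ≤⟨ primeCount-mono X≤x ⟩
    primeCount x      ∎
    where open ≤-Reasoning
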